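{- Let $\mathcal{F}$ be an unsatisfiable CNF formula with variable set $X$. Introduce fresh variables $x^+,x^0,x^1$ for each $x\in X$, let $X^+=\{x^+:x\in X\}$, and for each clause $c$ of $\mathcal{F}$ let $c^{0,1}$ be obtained by replacing each literal $x$ by $x^1$ and each literal $\neg x$ by $x^0$. Let $\mathcal{F}^{\mathrm{Aut}}$ be the CNF encoding of the constraints $x^1\leftrightarrow(x^+\wedge x)$ and $x^0\leftrightarrow(x^+\wedge\neg x)$ for all $x\in X$, together with the clauses $x^+\rightarrow c^{0,1}$ for every clause $c$ of $\mathcal{F}$ and every variable $x$ occurring in $c$. Let $\mathcal{R}=X^+$ and for $\mathcal{W}\subseteq\mathcal{R}$ let $P(\mathcal{W})=\neg\mathrm{SAT}\big(\mathcal{F}^{\mathrm{Aut}}\wedge\bigvee_{x^+\in\mathcal{R}\setminus\mathcal{W}}x^+\big)$. Then $P$ is monotone, and for a minimal subset $\mathcal{W}\subseteq\mathcal{R}$ for $P$ one has $\mathcal{F}^{\mathrm{Aut}}\models\bigwedge_{x^+\in\mathcal{R}\setminus\mathcal{W}}\neg x^+$, and $\{x\in X: x^+\in\mathcal{W}\}$ is the maximum autarky of $\mathcal{F}$. (Hence FAut reduces to the MSMP problem, via a predicate of form $\mathscr{B}$.)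
   Context: A CNF formula is a set of clauses. An empty disjunction is false. $\mathrm{SAT}(\varphi)$ is $1$ iff $\varphi$ is satisfiable. A set $\mathcal{A}$ of variables of $\mathcal{F}$ is an autarky iff some truth assignment to the variables in $\mathcal{A}$ satisfies every clause of $\mathcal{F}$ containing a literal over a variable in $\mathcal{A}$. A predicate $P:2^{\mathcal{R}}\to\{0,1\}$ is monotone if $P(\mathcal{R}_0)$ and $\mathcal{R}_0\subseteq\mathcal{R}_1\subseteq\mathcal{R}$ imply $P(\mathcal{R}_1)$; $\mathcal{M}\subseteq\mathcal{R}$ is minimal for $P$ if $P(\mathcal{M})$ holds and $P(\mathcal{M}')$ fails for every $\mathcal{M}'\subsetneq\mathcal{M}$. The MSMP problem asks for a minimal set for a given monotone predicate. -}

module Defs where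

open import Data.Bool using (Bool; true; false; not)
open import Data.Nat using (ℕ)
open import Data.Fin using (Fin)
open import Data.Fin.Subset using (Subset; _∈_; _∉_; _⊆_; _⊂_)
open import Data.Fin.Subset.Properties using (_∈?_)
open import Data.List using (List; []; _∷_; _++_; map; concatMap; filter)
open import Data.List.Base using (allFin)
open import Data.List.Membership.Propositional using () renaming (_∈_ to _∈ₗ_)
open import Data.List.Relation.Unary.All using (All)
open import Data.List.Relation.Unary.Any using (Any)
open import Data.Product using (Σ; ∃; _×_)
open import Relation.Nullary using (¬_)
open import Relation.Nullary.Decidable using (¬?)
open import Relation.Binary.PropositionalEquality using (_≡_)

data Literal (V : Set) : Set where
  pos : V → Literal V
  neg : V → Literal V

var : {V : Set} → Literal V → V
var (pos x) = x
var (neg x) = x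

Clause : Set → Set
Clause V = List (Literal V)

CNF : Set → Set
CNF V = List (Clause V)

Assignment : Set → Set
Assignment V = V → Bool

litVal : {V : Set} → Assignment V → Literal V → Bool
litVal σ (pos x) = σ x
litVal σ (neg x) = not (σ x)

SatClause : {V : Set} → Assignment V → Clause V → Set
SatClause σ c = Any (λ l → litVal σ l ≡ true) c

SatCNF : {V : Set} → Assignment V → CNF V → Set
SatCNF σ F = All (SatClause σ) F

SAT : {V : Set} → CNF V → Set
SAT {V} F = Σ (Assignment V) (λ σ → SatCNF σ F)

_⊨_ : {V : Set} → CNF V → CNF V → Set
_⊨_ {V} F G = (σ : Assignment V) → SatCNF σ F → SatCNF σ G

IsAutarky : {n : ℕ} → CNF (Fin n) → Subset n → Set
IsAutarky {n} F A =
  Σ (Assignment (Fin n)) λ τ →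
    (c : Clause (Fin n)) → c ∈ₗ F →
      Any (λ l → var l ∈ A) c →
      Any (λ l → (var l ∈ A) × (litVal τ l ≡ true)) c

IsMaximumAutarky : {n : ℕ} → CNF (Fin n) → Subset n → Set
IsMaximumAutarky F A = IsAutarky F A × ((B : _) → IsAutarky F B → B ⊆ A)

Monotone : {n : ℕ} → (Subset n → Set) → Set
Monotone {n} P = (R₀ R₁ : Subset n) → P R₀ → R₀ ⊆ R₁ → P R₁

IsMinimal : {n : ℕ} → (Subset n → Set) → Subset n → Set
IsMinimal {n} P M = P M × ((M' : Subset n) → M' ⊂ M → ¬ P M')

-- variables of F^Aut: original x, and fresh x⁺, x⁰, x¹
data AVar (n : ℕ) : Set where
  orig : Fin n → AVar n
  plus : Fin n → AVar n
  zer  : Fin n → AVar n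
  one  : Fin n → AVar n

lit01 : {n : ℕ} → Literal (Fin n) → Literal (AVar n)
lit01 (pos x) = pos (one x)
lit01 (neg x) = pos (zer x)

clause01 : {n : ℕ} → Clause (Fin n) → Clause (AVar n)
clause01 c = map lit01 c

-- CNF encoding of x¹ ↔ (x⁺ ∧ x) and x⁰ ↔ (x⁺ ∧ ¬x)
defClauses : {n : ℕ} → Fin n → CNF (AVar n)
defClauses x =
    (neg (one x) ∷ pos (plus x) ∷ [])
  ∷ (neg (one x) ∷ pos (orig x) ∷ [])
  ∷ (pos (one x) ∷ neg (plus x) ∷ neg (orig x) ∷ [])
  ∷ (neg (zer x) ∷ pos (plus x) ∷ [])
  ∷ (neg (zer x) ∷ neg (orig x) ∷ [])
  ∷ (pos (zer x) ∷ neg (plus x) ∷ pos (orig x) ∷ [])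
  ∷ []

implClauses : {n : ℕ} → CNF (Fin n) → CNF (AVar n)
implClauses F =
  concatMap (λ c → map (λ l → neg (plus (var l)) ∷ clause01 c) c) F

FAut : {n : ℕ} → CNF (Fin n) → CNF (AVar n)
FAut {n} F = concatMap defClauses (allFin n) ++ implClauses F

-- the variables x with x⁺ ∈ R \ W  (W ⊆ R = X⁺ represented as a Subset n)
outside : {n : ℕ} → Subset n → List (Fin n)
outside {n} W = filter (λ x → ¬? (x ∈? W)) (allFin n)

outsideClause : {n : ℕ} → Subset n → Clause (AVar n)
outsideClause W = map (λ x → pos (plus x)) (outside W)

outsideNegs : {n : ℕ} → Subset n → CNF (AVar n)
outsideNegs W = map (λ x → neg (plus x) ∷ []) (outside W)

PAut : {n : ℕ} → CNF (Fin n) → Subset n → Set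
PAut F W = ¬ SAT (outsideClause W ∷ FAut F)

-- The models of F^Aut are exactly the autarkies of F in disguise: a model σ makes
-- {x | σ(x⁺)} an autarky (witnessed by σ on the original variables), and every
-- autarky A with witness τ extends to a model with x⁺ := [x ∈ A].  Hence P(W) holds
-- iff every autarky lies inside W, which makes P monotone and gives the entailment.
-- If W is minimal, removing any x ∈ W breaks P, so x lies in some autarky; autarkies
-- are closed under finite unions, so W is covered by an autarky contained in W.
-- Constructively this needs the (finite) decidability of being an autarky.
module Submission where

open import Defs
open import Data.Nat using (ℕ)
open import Data.Fin using (Fin)
open import Data.Fin.Subset using (Subset; _∪_; _-_; ⋃)
  renaming (⊥ to ∅; _∈_ to _∈ₛ_; _∉_ to _∉ₛ_; _⊆_ to _⊆ₛ_)
open import Data.Fin.Subset.Properties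
  using ( _∈?_; ∉⊥; ⊆-antisym; ⊆-trans; p⊆p∪q; q⊆p∪q; x∈p∪q⁺; x∈p∪q⁻
        ; x∈p⇒p-x⊂p; x∈p∧x≢y⇒x∈p-y; anySubset?)
open import Data.Product using (_×_; _,_; ∃; proj₁; proj₂)
open import Data.Sum using ([_,_]′; inj₁; inj₂)
open import Data.Empty using (⊥-elim)
open import Data.Bool using (Bool; true; false; not; _∧_; if_then_else_)
open import Data.Bool.Properties using (not-¬; ¬-not) renaming (_≟_ to _≟ᵇ_)
open import Data.Vec using (lookup; tabulate)
open import Data.Vec.Properties using (lookup∘tabulate; []=⇒lookup; lookup⇒[]=)
open import Data.List using (List; []; _∷_; map; allFin)
open import Data.List.Relation.Unary.All as All using (All; []; _∷_; all?)
open import Data.List.Relation.Unary.All.Properties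
  using (++⁺; ++⁻ˡ; ++⁻ʳ; concat⁺; concat⁻; ¬Any⇒All¬)
  renaming (map⁺ to All-map⁺; map⁻ to All-map⁻)
open import Data.List.Relation.Unary.Any as Any using (Any; here; there; any?)
open import Data.List.Relation.Unary.Any.Properties using (singleton⁻)
  renaming (map⁺ to Any-map⁺; map⁻ to Any-map⁻)
open import Data.List.Membership.Propositional using (find; lose) renaming (_∈_ to _∈ₗ_)
open import Data.List.Membership.Propositional.Properties
  using (∈-allFin; ∈-map⁺; ∈-filter⁺; ∈-filter⁻)
open import Function using (_∘_; id; flip)
open import Relation.Nullary using (¬_; Dec; yes; no; does; contradiction)
open import Relation.Nullary.Decidable using (map′; _×-dec_; _→-dec_; ¬?; dec-true; dec-false)
open import Relation.Binary.PropositionalEquality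
  using (_≡_; _≢_; _≗_; refl; sym; trans; cong; cong₂; subst)

private
  variable
    n : ℕ
    V : Set

All∧Any⇒Any× : {A : Set} {P Q : A → Set} {xs : List A} →
  All P xs → Any Q xs → Any (λ x → P x × Q x) xs
All∧Any⇒Any× (p ∷ _) (here q) = here (p , q)
All∧Any⇒Any× (_ ∷ ps) (there q) = there (All∧Any⇒Any× ps q)

∈-tabulate⁺ : (f : Fin n → Bool) {x : Fin n} → f x ≡ true → x ∈ₛ tabulate f
∈-tabulate⁺ f {x} fx = lookup⇒[]= x (tabulate f) (trans (lookup∘tabulate f x) fx)

∈-tabulate⁻ : (f : Fin n → Bool) {x : Fin n} → x ∈ₛ tabulate f → f x ≡ true
∈-tabulate⁻ f {x} x∈ = trans (sym (lookup∘tabulate f x)) ([]=⇒lookup x∈)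

⊆⋃ : {C : Subset n} {Cs : List (Subset n)} → C ∈ₗ Cs → C ⊆ₛ ⋃ Cs
⊆⋃ {Cs = C ∷ Cs} (here refl) = p⊆p∪q (⋃ Cs)
⊆⋃ {Cs = C ∷ Cs} (there C∈) = ⊆-trans (⊆⋃ C∈) (q⊆p∪q C (⋃ Cs))

anyAssignment? : {P : Assignment (Fin n) → Set} → (∀ {τ τ'} → τ ≗ τ' → P τ → P τ') →
  ((τ : Assignment (Fin n)) → Dec (P τ)) → Dec (∃ P)
anyAssignment? {P = P} resp P? =
  map′ (λ (v , p) → lookup v , p)
       (λ (τ , p) → tabulate τ , resp (sym ∘ lookup∘tabulate τ) p)
       (anySubset? {P = P ∘ lookup} (P? ∘ lookup))

litVal-agree : (τ τ' : Assignment V) (l : Literal V) →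
  τ (var l) ≡ τ' (var l) → litVal τ l ≡ litVal τ' l
litVal-agree τ τ' (pos x) e = e
litVal-agree τ τ' (neg x) e = cong not e

satClause-dropFalse : {σ : Assignment V} {l : Literal V} {c : Clause V} →
  SatClause σ (l ∷ c) → litVal σ l ≡ false → SatClause σ c
satClause-dropFalse (here t) f = ⊥-elim (not-¬ t f)
satClause-dropFalse (there s) _ = s

satImplication : {σ : Assignment V} {a : V} {l : Literal V} →
  SatClause σ (neg a ∷ l ∷ []) → σ a ≡ true → litVal σ l ≡ true
satImplication s a = singleton⁻ (satClause-dropFalse s (cong not a))

AutarkyAssignment : CNF (Fin n) → Subset n → Assignment (Fin n) → Set
AutarkyAssignment {n} F A τ =
  (c : Clause (Fin n)) → c ∈ₗ F →
    Any (λ l → var l ∈ₛ A) c → Any (λ l → (var l ∈ₛ A) × (litVal τ l ≡ true)) c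

autarkyAssignment? : (F : CNF (Fin n)) (A : Subset n) (τ : Assignment (Fin n)) →
  Dec (AutarkyAssignment F A τ)
autarkyAssignment? F A τ =
  map′ (λ all c → All.lookup all) (λ aut → All.tabulate (λ {c} → aut c))
       (all? (λ c → any? (λ l → var l ∈? A) c
                    →-dec any? (λ l → var l ∈? A ×-dec litVal τ l ≟ᵇ true) c) F)

autarkyAssignment-resp : (F : CNF (Fin n)) (A : Subset n) {τ τ' : Assignment (Fin n)} →
  τ ≗ τ' → AutarkyAssignment F A τ → AutarkyAssignment F A τ'
autarkyAssignment-resp F A {τ} {τ'} τ≗τ' aut c c∈F touch =
  Any.map (λ {l} (l∈A , t) → l∈A , trans (sym (litVal-agree τ τ' l (τ≗τ' (var l)))) t)
          (aut c c∈F touch)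

isAutarky? : (F : CNF (Fin n)) (A : Subset n) → Dec (IsAutarky F A)
isAutarky? F A = anyAssignment? (autarkyAssignment-resp F A) (autarkyAssignment? F A)

autarkyContaining? : (F : CNF (Fin n)) (x : Fin n) →
  Dec (∃ λ C → IsAutarky F C × x ∈ₛ C)
autarkyContaining? F x = anySubset? (λ C → isAutarky? F C ×-dec x ∈? C)

∅-isAutarky : (F : CNF (Fin n)) → IsAutarky F ∅
∅-isAutarky F = (λ _ → true) , λ c _ touch → ⊥-elim (∉⊥ (proj₂ (Any.satisfied touch)))

∪-isAutarky : (F : CNF (Fin n)) {A B : Subset n} →
  IsAutarky F A → IsAutarky F B → IsAutarky F (A ∪ B)
∪-isAutarky {n} F {A} {B} (τA , autA) (τB , autB) = τ , sat
  where
  τ : Assignment (Fin n)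
  τ x = if does (x ∈? A) then τA x else τB x

  agreeA : {x : Fin n} → x ∈ₛ A → τ x ≡ τA x
  agreeA {x} x∈A rewrite dec-true (x ∈? A) x∈A = refl

  agreeB : {x : Fin n} → x ∉ₛ A → τ x ≡ τB x
  agreeB {x} x∉A rewrite dec-false (x ∈? A) x∉A = refl

  sat : AutarkyAssignment F (A ∪ B) τ
  sat c c∈F touch with any? (λ l → var l ∈? A) c
  ... | yes touchA =
    Any.map (λ {l} (l∈A , t) →
               x∈p∪q⁺ (inj₁ l∈A) , trans (litVal-agree τ τA l (agreeA l∈A)) t)
            (autA c c∈F touchA)
  ... | no ¬touchA =
    Any.map (λ {l} (l∉A , l∈B , t) →
               x∈p∪q⁺ (inj₂ l∈B) , trans (litVal-agree τ τB l (agreeB l∉A)) t)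
            (All∧Any⇒Any× outsideA (autB c c∈F touchB))
    where
    outsideA = ¬Any⇒All¬ c ¬touchA
    touchB = Any.map (λ (l∉A , l∈A∪B) → [ flip contradiction l∉A , id ]′ (x∈p∪q⁻ A B l∈A∪B))
                     (All∧Any⇒Any× outsideA touch)

⋃-isAutarky : (F : CNF (Fin n)) {Cs : List (Subset n)} →
  All (IsAutarky F) Cs → IsAutarky F (⋃ Cs)
⋃-isAutarky F [] = ∅-isAutarky F
⋃-isAutarky F (aut ∷ auts) = ∪-isAutarky F aut (⋃-isAutarky F auts)

implClause : Clause (Fin n) → Literal (Fin n) → Clause (AVar n)
implClause c l = neg (plus (var l)) ∷ clause01 c

module _ (F : CNF (Fin n)) {σ : Assignment (AVar n)} where

  satFAut⁺ : ((x : Fin n) → SatCNF σ (defClauses x)) →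
    (∀ {c} → c ∈ₗ F → All (SatClause σ ∘ implClause c) c) → SatCNF σ (FAut F)
  satFAut⁺ defs impls =
    ++⁺ (concat⁺ (All-map⁺ {f = defClauses}
                           (All.tabulate {xs = allFin n} (λ {x} _ → defs x))))
        (concat⁺ (All-map⁺ {f = λ c → map (implClause c) c}
                           (All.tabulate (λ c∈F → All-map⁺ {f = implClause _} (impls c∈F)))))

  satFAut⁻-defClauses : SatCNF σ (FAut F) → (x : Fin n) → SatCNF σ (defClauses x)
  satFAut⁻-defClauses sat x = All.lookup (All-map⁻ (concat⁻ (++⁻ˡ _ sat))) (∈-allFin x)

  satFAut⁻-implClauses : SatCNF σ (FAut F) →
    ∀ {c} → c ∈ₗ F → All (SatClause σ ∘ implClause c) c
  satFAut⁻-implClauses sat c∈F =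
    All-map⁻ (All.lookup (All-map⁻ (concat⁻ (++⁻ʳ _ sat))) c∈F)

defClauses-sat : (σ : Assignment (AVar n)) (x : Fin n) →
  σ (one x) ≡ σ (plus x) ∧ σ (orig x) → σ (zer x) ≡ σ (plus x) ∧ not (σ (orig x)) →
  SatCNF σ (defClauses x)
defClauses-sat σ x one≡ zer≡ with σ (plus x) in p | σ (orig x) in o
... | true  | true  = there (here p) ∷ there (here o) ∷ here one≡ ∷ here (cong not zer≡)
                    ∷ here (cong not zer≡) ∷ there (there (here o)) ∷ []
... | true  | false = here (cong not one≡) ∷ here (cong not one≡)
                    ∷ there (there (here (cong not o))) ∷ there (here p)
                    ∷ there (here (cong not o)) ∷ here zer≡ ∷ []
... | false | _     = here (cong not one≡) ∷ here (cong not one≡) ∷ there (here (cong not p))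
                    ∷ here (cong not zer≡) ∷ here (cong not zer≡)
                    ∷ there (here (cong not p)) ∷ []

lit01-true⇒ : {σ : Assignment (AVar n)} (l : Literal (Fin n)) →
  SatCNF σ (defClauses (var l)) →
  litVal σ (lit01 l) ≡ true → σ (plus (var l)) ≡ true × litVal (σ ∘ orig) l ≡ true
lit01-true⇒ (pos x) (c₁ ∷ c₂ ∷ _) t = satImplication c₁ t , satImplication c₂ t
lit01-true⇒ (neg x) (_ ∷ _ ∷ _ ∷ c₄ ∷ c₅ ∷ _) t = satImplication c₄ t , satImplication c₅ t

plusSet : Assignment (AVar n) → Subset n
plusSet σ = tabulate (σ ∘ plus)

model⇒autarky : (F : CNF (Fin n)) {σ : Assignment (AVar n)} →
  SatCNF σ (FAut F) → IsAutarky F (plusSet σ)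
model⇒autarky F {σ} sat = σ ∘ orig , λ c c∈F touch →
  let implSat , l∈plus = All.lookupAny (satFAut⁻-implClauses F sat c∈F) touch
      lit01Sat =
        Any-map⁻ (satClause-dropFalse implSat (cong not (∈-tabulate⁻ (σ ∘ plus) l∈plus)))
  in Any.map (λ {l} t → let p , o = lit01-true⇒ l (satFAut⁻-defClauses F sat (var l)) t
                        in ∈-tabulate⁺ (σ ∘ plus) p , o)
             lit01Sat

autarkyModel : Subset n → Assignment (Fin n) → Assignment (AVar n)
autarkyModel A τ (orig x) = τ x
autarkyModel A τ (plus x) = does (x ∈? A)
autarkyModel A τ (one x) = does (x ∈? A) ∧ τ x
autarkyModel A τ (zer x) = does (x ∈? A) ∧ not (τ x)

lit01-true⇐ : (A : Subset n) (τ : Assignment (Fin n)) (l : Literal (Fin n)) →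
  var l ∈ₛ A → litVal τ l ≡ true → litVal (autarkyModel A τ) (lit01 l) ≡ true
lit01-true⇐ A τ (pos x) x∈A t = cong₂ _∧_ (dec-true (x ∈? A) x∈A) t
lit01-true⇐ A τ (neg x) x∈A t = cong₂ _∧_ (dec-true (x ∈? A) x∈A) t

autarky⇒model : (F : CNF (Fin n)) {A : Subset n} {τ : Assignment (Fin n)} →
  AutarkyAssignment F A τ → SatCNF (autarkyModel A τ) (FAut F)
autarky⇒model F {A} {τ} aut =
  satFAut⁺ F (λ x → defClauses-sat σ x refl refl) (λ c∈F → All.tabulate (implSat c∈F))
  where
  σ = autarkyModel A τ

  implSat : ∀ {c l} → c ∈ₗ F → l ∈ₗ c → SatClause σ (implClause c l)
  implSat {c} {l} c∈F l∈c with var l ∈? A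
  ... | no l∉A = here (cong not (dec-false (var l ∈? A) l∉A))
  ... | yes l∈A =
    there (Any-map⁺ (Any.map (λ {l'} (l'∈A , t) → lit01-true⇐ A τ l' l'∈A t)
                             (aut c c∈F (lose l∈c l∈A))))

∈-outside⁺ : (W : Subset n) {x : Fin n} → x ∉ₛ W → x ∈ₗ outside W
∈-outside⁺ W x∉W = ∈-filter⁺ (λ x → ¬? (x ∈? W)) (∈-allFin _) x∉W

∈-outside⁻ : (W : Subset n) {x : Fin n} → x ∈ₗ outside W → x ∉ₛ W
∈-outside⁻ {n} W x∈out = proj₂ (∈-filter⁻ (λ x → ¬? (x ∈? W)) {xs = allFin n} x∈out)

outsideClause-sat⁺ : (W : Subset n) {σ : Assignment (AVar n)} {x : Fin n} →
  x ∉ₛ W → σ (plus x) ≡ true → SatClause σ (outsideClause W)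
outsideClause-sat⁺ W x∉W t = Any-map⁺ (lose (∈-outside⁺ W x∉W) t)

outsideClause-sat⁻ : (W : Subset n) {σ : Assignment (AVar n)} →
  SatClause σ (outsideClause W) → ∃ λ x → x ∉ₛ W × σ (plus x) ≡ true
outsideClause-sat⁻ W sat =
  let x , x∈out , t = find (Any-map⁻ sat) in x , ∈-outside⁻ W x∈out , t

module _ (F : CNF (Fin n)) where

  PAut⇒autarky⊆ : (W : Subset n) → PAut F W → {C : Subset n} → IsAutarky F C → C ⊆ₛ W
  PAut⇒autarky⊆ W PW {C} (τ , aut) {x} x∈C with x ∈? W
  ... | yes x∈W = x∈W
  ... | no x∉W = ⊥-elim (PW (autarkyModel C τ , out ∷ autarky⇒model F aut))
    where out = outsideClause-sat⁺ W x∉W (dec-true (x ∈? C) x∈C)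

  autarky⊆⇒PAut : (W : Subset n) → ({C : Subset n} → IsAutarky F C → C ⊆ₛ W) → PAut F W
  autarky⊆⇒PAut W bound (σ , out ∷ sat) =
    let x , x∉W , t = outsideClause-sat⁻ W out
    in x∉W (bound (model⇒autarky F sat) (∈-tabulate⁺ (σ ∘ plus) t))

  PAut-monotone : Monotone (PAut F)
  PAut-monotone R₀ R₁ P₀ R₀⊆R₁ =
    autarky⊆⇒PAut R₁ λ aut x∈C → R₀⊆R₁ (PAut⇒autarky⊆ R₀ P₀ aut x∈C)

  PAut⇒entails : (W : Subset n) → PAut F W → FAut F ⊨ outsideNegs W
  PAut⇒entails W PW σ sat = All-map⁺ (All.tabulate λ x∈out → here (cong not (¬-not (plus≢true x∈out))))
    where
    plus≢true : {x : Fin n} → x ∈ₗ outside W → σ (plus x) ≢ true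
    plus≢true x∈out t =
      ∈-outside⁻ W x∈out (PAut⇒autarky⊆ W PW (model⇒autarky F sat) (∈-tabulate⁺ (σ ∘ plus) t))

  minimal⇒autarkyContaining : (W : Subset n) → IsMinimal (PAut F) W →
    {x : Fin n} → x ∈ₛ W → ∃ λ C → IsAutarky F C × x ∈ₛ C
  minimal⇒autarkyContaining W (PW , minimal) {x} x∈W with autarkyContaining? F x
  ... | yes found = found
  ... | no none = ⊥-elim (minimal (W - x) (x∈p⇒p-x⊂p x∈W) (autarky⊆⇒PAut (W - x) bound))
    where
    bound : {C : Subset n} → IsAutarky F C → C ⊆ₛ W - x
    bound {C} aut {y} y∈C =
      x∈p∧x≢y⇒x∈p-y (PAut⇒autarky⊆ W PW aut y∈C) λ { refl → none (C , aut , y∈C) }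

  minimal⇒maximumAutarky : (W : Subset n) → IsMinimal (PAut F) W → IsMaximumAutarky F W
  minimal⇒maximumAutarky W minW@(PW , _) =
    subst (IsAutarky F) (⊆-antisym (PAut⇒autarky⊆ W PW U-aut) W⊆U) U-aut ,
    λ _ → PAut⇒autarky⊆ W PW
    where
    cover : (x : Fin n) → ∃ λ C → IsAutarky F C × (x ∈ₛ W → x ∈ₛ C)
    cover x with x ∈? W
    ... | yes x∈W =
      let C , aut , x∈C = minimal⇒autarkyContaining W minW x∈W in C , aut , λ _ → x∈C
    ... | no x∉W = ∅ , ∅-isAutarky F , λ x∈W → contradiction x∈W x∉W

    Cs : List (Subset n)
    Cs = map (proj₁ ∘ cover) (allFin n)

    U-aut : IsAutarky F (⋃ Cs)
    U-aut = ⋃-isAutarky F (All-map⁺ {f = proj₁ ∘ cover}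
                                    (All.tabulate {xs = allFin n} λ {x} _ → proj₁ (proj₂ (cover x))))

    W⊆U : W ⊆ₛ ⋃ Cs
    W⊆U {x} x∈W = ⊆⋃ (∈-map⁺ (proj₁ ∘ cover) (∈-allFin x)) (proj₂ (proj₂ (cover x)) x∈W)

proposition25 : (n : ℕ) (F : CNF (Fin n)) → ¬ SAT F →
    Monotone (PAut F)
    × ((W : Subset n) → IsMinimal (PAut F) W →
    (FAut F ⊨ outsideNegs W) × IsMaximumAutarky F W)
proposition25 n F _ =
  PAut-monotone F ,
  λ W minW → PAut⇒entails F W (proj₁ minW) , minimal⇒maximumAutarky F W minW
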